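{- Let $X$ and $Y$ be induced subgraphs of $\overline{\mathbb{C}_3}$ and let $f\colon X\to Y$ be a graph isomorphism such that for every $x\in V(X)$ and every $p\in P$ we have $px\in E(\overline{\mathbb{C}_3})$ if and only if $pf(x)\in E(\overline{\mathbb{C}_3})$. Then for every edge $xy\in E(X)$, $$\sigma_{\overline{\mathbb{C}_3}}(f(x)f(y))=\sigma_{\overline{\mathbb{C}_3}}(xy)+i(x)+i(f(x))+i(y)+i(f(y))$$ (in $\mathbb{Z}_2$).
   Context: The graph $\mathbb{C}_3$ has as vertices the unit complex numbers with rational argument (range of $\arg$ is $(-\pi,\pi]$), two distinct vertices $z,w$ being adjacent iff $|\arg(z/w)|>\frac{2}{3}\pi$; $\overline{\mathbb{C}_3}$ is its complement. A labelling of a graph $G$ is a map $\sigma\colon E(G)\to\mathbb{Z}_2$, and $\sigma(H)=\sum_{e\in E(H)}\sigma(e)$ for a subgraph $H$; it is anti-even-balancing if every induced cycle $C$ has $\sigma(C)=0$ if $|V(C)|=3$ and $\sigma(C)=1$ otherwise. Fixed data: a partition $V(\overline{\mathbb{C}_3})=C_0\cup C_1$ into two disjoint subsets each dense in the unit circle; for $x$ a vertex, $i(x)\in\{0,1\}$ is the index with $x\in C_{i(x)}$; a set $P=\{p^0,\dots,p^4\}$ of vertices on which $\overline{\mathbb{C}_3}$ induces a $5$-cycle, enumerated so that $p^jp^{j+1}\in E(\overline{\mathbb{C}_3})$ for all $j$ (indices mod $5$). For each vertex $x$, $p_x:=p^j$ where $j$ is the smallest index with $xp^j\in E(\overline{\mathbb{C}_3})$.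 Let $T$ be the spanning tree of $\overline{\mathbb{C}_3}$ with edges $\{xp_x : x\in V(\overline{\mathbb{C}_3})\}$ and $\sigma_T(xp_x)=i(x)$. Then $\sigma_{\overline{\mathbb{C}_3}}$ is the unique anti-even-balancing labelling of $\overline{\mathbb{C}_3}$ whose restriction to $E(T)$ is $\sigma_T$. -}

module Defs where

open import Data.Bool using (Bool; true; false; if_then_else_; _xor_)
open import Data.Nat using (ℕ; zero; suc; _<_)
open import Data.Nat.DivMod using (_mod_)
open import Data.Fin using (Fin; toℕ) renaming (_<_ to _<ᶠ_)
open import Data.Integer using (+_)
open import Data.Rational using (ℚ; _/_; ½; -½; 0ℚ; 1ℚ; ∣_∣; _-_; _+_)
  renaming (_<_ to _<ℚ_; _≤_ to _≤ℚ_)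
open import Data.Rational.Properties using (_<?_; _≤?_)
open import Data.Product using (Σ; _×_; ∃)
open import Data.Sum using (_⊎_)
open import Relation.Nullary using (¬_; does)
open import Relation.Binary.PropositionalEquality using (_≡_; _≢_)
open import Function.Bundles using (_⇔_)

-- Vertices of C₃: unit complex numbers e^{iθ} with θ = 2π·a, a ∈ ℚ,
-- θ ∈ (-π, π]  i.e.  a ∈ (-1/2, 1/2].  The argument is stored in units
-- of a full turn (2π).  The range proofs are irrelevant, so two vertices
-- are equal iff their arguments are equal.

record Vert : Set where
  constructor mkV
  field
    arg : ℚ
    .lo : -½ <ℚ arg
    .hi : arg ≤ℚ ½
open Vert public

⅓ : ℚ
⅓ = + 1 / 3

-- principal value (in (-1/2,1/2], units of 2π) of a difference of arguments
-- d ∈ (-1,1); this is arg(z/w) for d = arg z - arg w.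
reduce : ℚ → ℚ
reduce d = if does (½ <? d) then d - 1ℚ
           else if does (d ≤? -½) then d + 1ℚ else d

argQuot : Vert → Vert → ℚ
argQuot z w = reduce (arg z - arg w)

C3Adj : Vert → Vert → Set
C3Adj z w = (z ≢ w) × (⅓ <ℚ ∣ argQuot z w ∣)

Adj : Vert → Vert → Set
Adj z w = (z ≢ w) × ¬ C3Adj z w

-- The partition C₀ ∪ C₁ is given by the index map i : Vert → Bool
-- (false = 0, true = 1, Bool with xor = ℤ₂); x ∈ C_{i x}.
-- C_b is dense in the unit circle: every (rational-argument) point of the
-- circle has points of C_b arbitrarily close (rational-argument points are
-- dense, so this is density in the circle).

DenseClass : (Vert → Bool) → Bool → Set
DenseClass i b = ∀ (v : Vert) (ε : ℚ) → 0ℚ <ℚ ε →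
  Σ Vert (λ w → (i w ≡ b) × (∣ argQuot w v ∣ <ℚ ε))

next : ∀ {n} → Fin (suc n) → Fin (suc n)
next {n} j = suc (toℕ j) mod (suc n)

InducedFiveCycle : (Fin 5 → Vert) → Set
InducedFiveCycle p =
  (∀ j k → p j ≡ p k → j ≡ k) ×
  (∀ j k → Adj (p j) (p k) ⇔ ((k ≡ next j) ⊎ (j ≡ next k)))

InducedCycle : (m : ℕ) → (Fin (3 Data.Nat.+ m) → Vert) → Set
InducedCycle m c =
  (∀ j k → c j ≡ c k → j ≡ k) ×
  (∀ j k → Adj (c j) (c k) ⇔ ((k ≡ next j) ⊎ (j ≡ next k)))

sumℤ₂ : ∀ {n} → (Fin n → Bool) → Bool
sumℤ₂ {zero} f = false
sumℤ₂ {suc n} f = f Data.Fin.zero xor sumℤ₂ (λ j → f (Data.Fin.suc j))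

-- Labellings σ : E → ℤ₂, represented as a function on ordered pairs
-- which is symmetric on edges (values on non-edges are irrelevant).

Labelling : Set
Labelling = Vert → Vert → Bool

SymmetricOnEdges : Labelling → Set
SymmetricOnEdges σ = ∀ x y → Adj x y → σ x y ≡ σ y x

cycleSum : ∀ {m} → Labelling → (Fin (3 Data.Nat.+ m) → Vert) → Bool
cycleSum σ c = sumℤ₂ (λ j → σ (c j) (c (next j)))

lengthParity : ℕ → Bool
lengthParity zero = false     -- |V(C)| = 3
lengthParity (suc _) = true   -- |V(C)| > 3

AntiEvenBalancing : Labelling → Set
AntiEvenBalancing σ =
  ∀ (m : ℕ) (c : Fin (3 Data.Nat.+ m) → Vert) → InducedCycle m c →
    cycleSum σ c ≡ lengthParity m

IsPx : (Fin 5 → Vert) → Vert → Fin 5 → Set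
IsPx p x j = Adj x (p j) × (∀ k → k <ᶠ j → ¬ Adj x (p k))

-- σ restricted to the tree T (edges x p_x) equals σ_T (x p_x ↦ i x)
ExtendsσT : (Vert → Bool) → (Fin 5 → Vert) → Labelling → Set
ExtendsσT i p σ = ∀ x j → IsPx p x j → σ x (p j) ≡ i x

IsSigmaC3 : (Vert → Bool) → (Fin 5 → Vert) → Labelling → Set
IsSigmaC3 i p σ = SymmetricOnEdges σ × AntiEvenBalancing σ × ExtendsσT i p σ

-- induced subgraphs X, Y given by vertex sets; f : X → Y an isomorphism
-- of the induced subgraphs (f does not depend on the membership proof).

IsInducedIso : (X Y : Vert → Set) → ((x : Vert) → .(X x) → Vert) → Set
IsInducedIso X Y f =
  (∀ x (hx : X x) → Y (f x hx)) ×
  (∀ x y (hx : X x) (hy : X y) → f x hx ≡ f y hy → x ≡ y) ×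
  (∀ y → Y y → Σ Vert (λ x → Σ (X x) (λ hx → f x hx ≡ y))) ×
  (∀ x y (hx : X x) (hy : X y) → Adj x y ⇔ Adj (f x hx) (f y hy))

PreservesP : (Fin 5 → Vert) → (X : Vert → Set) → ((x : Vert) → .(X x) → Vert) → Set
PreservesP p X f = ∀ x (hx : X x) (j : Fin 5) → Adj (p j) x ⇔ Adj (p j) (f x hx)

{-# OPTIONS --safe #-}
module Submission where

-- Switching σ at C₁ gives τ(xy) = σ(xy) + i(x) + i(y), which still sums to 0 on triangles and has
-- τ(x p_x) = i(p_x); we show that f preserves τ.  No three points of the circle are pairwise more
-- than 2π/3 apart, so the non-neighbours of a vertex are pairwise adjacent in the complement of C₃.
-- Hence a vertex x outside P misses at most two consecutive vertices of the pentagon P, its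
-- neighbours on P are connected along the pentagon, and the triangles x pʲ pʲ⁺¹ determine every
-- τ(x pʲ) from τ(x p_x) = i(p_x).  Since f(x) has the same neighbours on P, τ(f(x) pʲ) = τ(x pʲ);
-- the same fact forces f to fix P pointwise.  Finally two vertices outside P have a common
-- neighbour on P, and the triangle through it carries τ(xy) to τ(f(x) f(y)).

open import Defs
open import Data.Bool using (Bool; true; false; not; _xor_; if_then_else_)
open import Data.Bool.Properties using (xor-comm)
open import Data.Bool.Solver using (module xor-∧-Solver)
open import Data.Empty using (⊥; ⊥-elim)
open import Data.Fin using (Fin; zero; suc; fromℕ<; #_) renaming (_<_ to _<ᶠ_)
open import Data.Fin.Properties using (all?; any?; ¬∀⟶∃¬-smallest; toℕ-injective; toℕ-inject; toℕ-fromℕ<)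
  renaming (_≟_ to _≟ᶠ_)
import Data.Nat as ℕ
open import Data.Integer using (+_)
open import Data.Product using (∃; _×_; _,_; proj₁; proj₂)
open import Data.Rational using (ℚ; _/_; ½; -½; 0ℚ; 1ℚ; ∣_∣; _+_; _-_; -_; _<_; _≤_)
open import Data.Rational.Properties
  using (_≟_; _<?_; _≤?_; <-irrefl; <-asym; <-trans; <-≤-trans; ≤-<-trans; <⇒≤; ≮⇒≥; ≰⇒>;
         ≤-refl; ≤-trans; ≤-reflexive; +-mono-<; +-monoˡ-<; +-mono-<-≤; +-mono-≤-<; +-inverseʳ; +-identityˡ;
         neg-antimono-<; neg-antimono-≤; ∣p∣≡p∨∣p∣≡-p; ∣-p∣≡∣p∣; 0≤p⇒∣p∣≡p)
open import Data.Rational.Solver using (module +-*-Solver)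
open import Data.Sum using (_⊎_; inj₁; inj₂)
open import Function using (_∘_; id)
open import Function.Bundles using (_⇔_; mk⇔; Equivalence)
open import Relation.Nullary using (¬_; Dec; yes; no; does)
open import Relation.Nullary.Decidable
  using (from-yes; recompute; map′; decidable-stable; ¬?; _×-dec_; _⊎-dec_; _→-dec_)
open import Relation.Binary.PropositionalEquality
  using (_≡_; _≢_; refl; sym; trans; cong; cong₂; subst; subst₂; module ≡-Reasoning)

open Equivalence
open ≡-Reasoning

module _ where
  open +-*-Solver

  ⅔ : ℚ
  ⅔ = + 2 / 3

  p<q⇒0<q-p : ∀ {p q} → p < q → 0ℚ < q - p
  p<q⇒0<q-p {p} {q} p<q = subst (_< q - p) (+-inverseʳ p) (+-monoˡ-< (- p) p<q)

  <-by-difference : ∀ {a b c d} → b - a ≡ d - c → a < b → c < d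
  <-by-difference {c = c} {d} b-a≡d-c a<b =
    subst₂ _<_ (+-identityˡ c) (solve 2 (λ c d → (d :- c) :+ c := d) refl c d)
      (+-monoˡ-< c (subst (0ℚ <_) b-a≡d-c (p<q⇒0<q-p a<b)))

  gap-sum-contradiction : ∀ {a₁ b₁ a₂ b₂ a₃ b₃ k} → a₁ < b₁ → a₂ < b₂ → a₃ < b₃ →
                          (b₁ - a₁) + (b₂ - a₂) + (b₃ - a₃) ≡ k → k ≤ 0ℚ → ⊥
  gap-sum-contradiction h₁ h₂ h₃ sum≡k k≤0 = <-irrefl refl (<-≤-trans
    (+-mono-< (+-mono-< (p<q⇒0<q-p h₁) (p<q⇒0<q-p h₂)) (p<q⇒0<q-p h₃))
    (≤-trans (≤-reflexive sum≡k) k≤0))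

  ⅓<∣r∣⇒⅓<r∨r<-⅓ : ∀ r → ⅓ < ∣ r ∣ → ⅓ < r ⊎ r < - ⅓
  ⅓<∣r∣⇒⅓<r∨r<-⅓ r ⅓<∣r∣ with ∣p∣≡p∨∣p∣≡-p r
  ... | inj₁ ∣r∣≡r  = inj₁ (subst (⅓ <_) ∣r∣≡r ⅓<∣r∣)
  ... | inj₂ ∣r∣≡-r = inj₂ (<-by-difference (solve 1 (λ r → (:- r) :- con ⅓ := con (- ⅓) :- r) refl r)
                                            (subst (⅓ <_) ∣r∣≡-r ⅓<∣r∣))

  ⅓<r∨r<-⅓⇒⅓<∣r∣ : ∀ r → ⅓ < r ⊎ r < - ⅓ → ⅓ < ∣ r ∣
  ⅓<r∨r<-⅓⇒⅓<∣r∣ r (inj₁ ⅓<r) =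
    subst (⅓ <_) (sym (0≤p⇒∣p∣≡p (<⇒≤ (<-trans (from-yes (0ℚ <? ⅓)) ⅓<r)))) ⅓<r
  ⅓<r∨r<-⅓⇒⅓<∣r∣ r (inj₂ r<-⅓) =
    subst (⅓ <_) (trans (sym (0≤p⇒∣p∣≡p (<⇒≤ (<-trans (from-yes (0ℚ <? ⅓)) ⅓<-r)))) (∣-p∣≡∣p∣ r))
      ⅓<-r
    where
    ⅓<-r : ⅓ < - r
    ⅓<-r = <-by-difference (solve 1 (λ r → con (- ⅓) :- r := (:- r) :- con ⅓) refl r) r<-⅓

  Band : ℚ → Set
  Band d = (⅓ < d × d < ⅔) ⊎ (- ⅔ < d × d < - ⅓)

  band-neg : ∀ {d} → Band d → Band (- d)
  band-neg (inj₁ (⅓<d , d<⅔))   = inj₂ (neg-antimono-< d<⅔ , neg-antimono-< ⅓<d)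
  band-neg (inj₂ (-⅔<d , d<-⅓)) = inj₁ (neg-antimono-< d<-⅓ , neg-antimono-< -⅔<d)

  -- In each case three of the six bounds have slacks summing to 0 or -1.
  band-triangle-free : ∀ s t → Band s → Band t → ¬ Band (t - s)
  band-triangle-free s t (inj₁ (⅓<s , s<⅔)) (inj₁ (⅓<t , t<⅔)) (inj₁ (⅓<u , u<⅔)) =
    gap-sum-contradiction ⅓<u ⅓<s t<⅔
      (solve 2 (λ s t → (((t :- s) :- con ⅓) :+ (s :- con ⅓)) :+ (con ⅔ :- t) := con 0ℚ) refl s t) ≤-refl
  band-triangle-free s t (inj₁ (⅓<s , s<⅔)) (inj₁ (⅓<t , t<⅔)) (inj₂ (-⅔<u , u<-⅓)) =
    gap-sum-contradiction u<-⅓ ⅓<t s<⅔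
      (solve 2 (λ s t → ((con (- ⅓) :- (t :- s)) :+ (t :- con ⅓)) :+ (con ⅔ :- s) := con 0ℚ) refl s t) ≤-refl
  band-triangle-free s t (inj₁ (⅓<s , s<⅔)) (inj₂ (-⅔<t , t<-⅓)) (inj₁ (⅓<u , u<⅔)) =
    gap-sum-contradiction t<-⅓ ⅓<s ⅓<u
      (solve 2 (λ s t → ((con (- ⅓) :- t) :+ (s :- con ⅓)) :+ ((t :- s) :- con ⅓) := con (- 1ℚ)) refl s t)
      (from-yes (- 1ℚ ≤? 0ℚ))
  band-triangle-free s t (inj₁ (⅓<s , s<⅔)) (inj₂ (-⅔<t , t<-⅓)) (inj₂ (-⅔<u , u<-⅓)) =
    gap-sum-contradiction t<-⅓ ⅓<s -⅔<u
      (solve 2 (λ s t → ((con (- ⅓) :- t) :+ (s :- con ⅓)) :+ ((t :- s) :- con (- ⅔)) := con 0ℚ) refl s t) ≤-refl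
  band-triangle-free s t (inj₂ (-⅔<s , s<-⅓)) (inj₁ (⅓<t , t<⅔)) (inj₁ (⅓<u , u<⅔)) =
    gap-sum-contradiction s<-⅓ ⅓<t u<⅔
      (solve 2 (λ s t → ((con (- ⅓) :- s) :+ (t :- con ⅓)) :+ (con ⅔ :- (t :- s)) := con 0ℚ) refl s t) ≤-refl
  band-triangle-free s t (inj₂ (-⅔<s , s<-⅓)) (inj₁ (⅓<t , t<⅔)) (inj₂ (-⅔<u , u<-⅓)) =
    gap-sum-contradiction s<-⅓ ⅓<t u<-⅓
      (solve 2 (λ s t → ((con (- ⅓) :- s) :+ (t :- con ⅓)) :+ (con (- ⅓) :- (t :- s)) := con (- 1ℚ)) refl s t)
      (from-yes (- 1ℚ ≤? 0ℚ))
  band-triangle-free s t (inj₂ (-⅔<s , s<-⅓)) (inj₂ (-⅔<t , t<-⅓)) (inj₁ (⅓<u , u<⅔)) =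
    gap-sum-contradiction ⅓<u -⅔<s t<-⅓
      (solve 2 (λ s t → (((t :- s) :- con ⅓) :+ (s :- con (- ⅔))) :+ (con (- ⅓) :- t) := con 0ℚ) refl s t) ≤-refl
  band-triangle-free s t (inj₂ (-⅔<s , s<-⅓)) (inj₂ (-⅔<t , t<-⅓)) (inj₂ (-⅔<u , u<-⅓)) =
    gap-sum-contradiction u<-⅓ -⅔<t s<-⅓
      (solve 2 (λ s t → ((con (- ⅓) :- (t :- s)) :+ (t :- con (- ⅔))) :+ (con (- ⅓) :- s) := con 0ℚ) refl s t) ≤-refl

  data Reduction (d : ℚ) : Set where
    wrap-down : ½ < d → reduce d ≡ d - 1ℚ → Reduction d
    wrap-up   : d ≤ -½ → reduce d ≡ d + 1ℚ → Reduction d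
    unchanged : -½ < d → d ≤ ½ → reduce d ≡ d → Reduction d

  reduction : ∀ d → Reduction d
  reduction d = view (½ <? d) (d ≤? -½) refl
    where
    view : (>½ : Dec (½ < d)) (≤-½ : Dec (d ≤ -½)) →
           reduce d ≡ (if does >½ then d - 1ℚ else if does ≤-½ then d + 1ℚ else d) → Reduction d
    view (yes ½<d) _          = wrap-down ½<d
    view (no  ½≮d) (yes d≤-½) = wrap-up d≤-½
    view (no  ½≮d) (no  d≰-½) = unchanged (≰⇒> d≰-½) (≮⇒≥ ½≮d)

  band⇒⅓<∣reduce∣ : ∀ d → Band d → ⅓ < ∣ reduce d ∣
  band⇒⅓<∣reduce∣ d band = ⅓<r∨r<-⅓⇒⅓<∣r∣ (reduce d) (go (reduction d) band)
    where
    go : Reduction d → Band d → ⅓ < reduce d ⊎ reduce d < - ⅓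
    go (wrap-down ½<d r≡d-1) (inj₁ (_ , d<⅔)) = inj₂ (subst (_< - ⅓) (sym r≡d-1)
      (<-by-difference (solve 1 (λ d → con ⅔ :- d := con (- ⅓) :- (d :- con 1ℚ)) refl d) d<⅔))
    go (wrap-down ½<d _) (inj₂ (_ , d<-⅓)) = ⊥-elim (<-asym ½<d (<-trans d<-⅓ (from-yes (- ⅓ <? ½))))
    go (wrap-up d≤-½ _) (inj₁ (⅓<d , _)) = ⊥-elim (<-asym (≤-<-trans d≤-½ (from-yes (-½ <? ⅓))) ⅓<d)
    go (wrap-up d≤-½ r≡d+1) (inj₂ (-⅔<d , _)) = inj₁ (subst (⅓ <_) (sym r≡d+1)
      (<-by-difference (solve 1 (λ d → d :- con (- ⅔) := (d :+ con 1ℚ) :- con ⅓) refl d) -⅔<d))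
    go (unchanged _ _ r≡d) (inj₁ (⅓<d , _)) = inj₁ (subst (⅓ <_) (sym r≡d) ⅓<d)
    go (unchanged _ _ r≡d) (inj₂ (_ , d<-⅓)) = inj₂ (subst (_< - ⅓) (sym r≡d) d<-⅓)

  ⅓<∣reduce∣⇒band : ∀ d → - 1ℚ < d → d < 1ℚ → ⅓ < ∣ reduce d ∣ → Band d
  ⅓<∣reduce∣⇒band d -1<d d<1 far = go (reduction d) (⅓<∣r∣⇒⅓<r∨r<-⅓ (reduce d) far)
    where
    go : Reduction d → ⅓ < reduce d ⊎ reduce d < - ⅓ → Band d
    go (wrap-down ½<d r≡d-1) (inj₁ ⅓<r) = ⊥-elim (<-asym d<1 (<-trans (from-yes (1ℚ <? + 4 / 3))
      (<-by-difference (solve 1 (λ d → (d :- con 1ℚ) :- con ⅓ := d :- con (+ 4 / 3)) refl d)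
        (subst (⅓ <_) r≡d-1 ⅓<r))))
    go (wrap-down ½<d r≡d-1) (inj₂ r<-⅓) = inj₁ (<-trans (from-yes (⅓ <? ½)) ½<d ,
      <-by-difference (solve 1 (λ d → con (- ⅓) :- (d :- con 1ℚ) := con ⅔ :- d) refl d)
        (subst (_< - ⅓) r≡d-1 r<-⅓))
    go (wrap-up d≤-½ r≡d+1) (inj₁ ⅓<r) = inj₂
      (<-by-difference (solve 1 (λ d → (d :+ con 1ℚ) :- con ⅓ := d :- con (- ⅔)) refl d)
         (subst (⅓ <_) r≡d+1 ⅓<r) ,
       ≤-<-trans d≤-½ (from-yes (-½ <? - ⅓)))
    go (wrap-up d≤-½ r≡d+1) (inj₂ r<-⅓) = ⊥-elim (<-asym -1<d (<-trans
      (<-by-difference (solve 1 (λ d → con (- ⅓) :- (d :+ con 1ℚ) := con (- (+ 4 / 3)) :- d) refl d)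
        (subst (_< - ⅓) r≡d+1 r<-⅓))
      (from-yes (- (+ 4 / 3) <? - 1ℚ))))
    go (unchanged _ d≤½ r≡d) (inj₁ ⅓<r) =
      inj₁ (subst (⅓ <_) r≡d ⅓<r , ≤-<-trans d≤½ (from-yes (½ <? ⅔)))
    go (unchanged -½<d _ r≡d) (inj₂ r<-⅓) =
      inj₂ (<-trans (from-yes (- ⅔ <? -½)) -½<d , subst (_< - ⅓) r≡d r<-⅓)

  Far : Vert → Vert → Set
  Far z w = ⅓ < ∣ argQuot z w ∣

  arg-lower : ∀ z → -½ < arg z
  arg-lower (mkV a lo _) = recompute (-½ <? a) lo

  arg-upper : ∀ z → arg z ≤ ½
  arg-upper (mkV a _ hi) = recompute (a ≤? ½) hi

  far⇒band : ∀ z w → Far z w → Band (arg z - arg w)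
  far⇒band z w = ⅓<∣reduce∣⇒band (arg z - arg w)
    (+-mono-<-≤ (arg-lower z) (neg-antimono-≤ (arg-upper w)))
    (+-mono-≤-< (arg-upper z) (neg-antimono-< (arg-lower w)))

  Far-sym : ∀ z w → Far z w → Far w z
  Far-sym z w far = band⇒⅓<∣reduce∣ (arg w - arg z)
    (subst Band (solve 2 (λ a b → :- (a :- b) := b :- a) refl (arg z) (arg w)) (band-neg (far⇒band z w far)))

  Far-triangle-free : ∀ v a b → Far v a → Far v b → ¬ Far a b
  Far-triangle-free v a b va vb ab =
    band-triangle-free (arg v - arg a) (arg v - arg b) (far⇒band v a va) (far⇒band v b vb)
      (subst Band (solve 3 (λ v a b → a :- b := (v :- b) :- (v :- a)) refl (arg v) (arg a) (arg b))
        (far⇒band a b ab))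

_≟ᵥ_ : (z w : Vert) → Dec (z ≡ w)
mkV a _ _ ≟ᵥ mkV b _ _ = map′ (λ { refl → refl }) (cong arg) (a ≟ b)

C3Adj? : ∀ z w → Dec (C3Adj z w)
C3Adj? z w = ¬? (z ≟ᵥ w) ×-dec (⅓ <? ∣ argQuot z w ∣)

Adj? : ∀ z w → Dec (Adj z w)
Adj? z w = ¬? (z ≟ᵥ w) ×-dec ¬? (C3Adj? z w)

Adj-irrefl : ∀ {z} → ¬ Adj z z
Adj-irrefl (z≢z , _) = z≢z refl

Adj-sym : ∀ {z w} → Adj z w → Adj w z
Adj-sym {z} {w} (z≢w , ¬zw) = z≢w ∘ sym , λ (_ , wz) → ¬zw (z≢w , Far-sym w z wz)

non-adjacent⇒C3Adj : ∀ {z w} → z ≢ w → ¬ Adj z w → C3Adj z w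
non-adjacent⇒C3Adj {z} {w} z≢w ¬zw = decidable-stable (C3Adj? z w) (λ ¬c → ¬zw (z≢w , ¬c))

non-neighbours-adjacent : ∀ {v a b} → v ≢ a → v ≢ b → a ≢ b → ¬ Adj v a → ¬ Adj v b → Adj a b
non-neighbours-adjacent {v} {a} {b} v≢a v≢b a≢b ¬va ¬vb = a≢b , λ (_ , ab) →
  Far-triangle-free v a b (proj₂ (non-adjacent⇒C3Adj v≢a ¬va)) (proj₂ (non-adjacent⇒C3Adj v≢b ¬vb)) ab

least-witness : ∀ {n} {P : Fin n → Set} → (∀ j → Dec (P j)) → ∃ P →
                ∃ λ j → P j × (∀ k → k <ᶠ j → ¬ P k)
least-witness {n} {P} P? (j , Pj) with ¬∀⟶∃¬-smallest n (¬_ ∘ P) (¬? ∘ P?) (λ none → none j Pj)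
... | m , ¬¬Pm , below = m , decidable-stable (P? m) ¬¬Pm , λ k k<m →
  subst (¬_ ∘ P) (toℕ-injective (trans (toℕ-inject (fromℕ< k<m)) (toℕ-fromℕ< k<m))) (below (fromℕ< k<m))

Consecutive : ∀ {n} → Fin (ℕ.suc n) → Fin (ℕ.suc n) → Set
Consecutive j k = k ≡ next j ⊎ j ≡ next k

consecutive? : ∀ {n} (j k : Fin (ℕ.suc n)) → Dec (Consecutive j k)
consecutive? j k = (k ≟ᶠ next j) ⊎-dec (j ≟ᶠ next k)

Close : ∀ {n} → Fin (ℕ.suc n) → Fin (ℕ.suc n) → Set
Close j k = j ≡ k ⊎ Consecutive j k

close? : ∀ {n} (j k : Fin (ℕ.suc n)) → Dec (Close j k)
close? j k = (j ≟ᶠ k) ⊎-dec consecutive? j k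

pentagram : ∀ (j : Fin 5) → ¬ Close j (next (next j))
pentagram = from-yes (all? {n = 5} λ j → ¬? (close? j (next (next j))))

Detour : Fin 5 → Fin 5 → Set
Detour j k = ∃ λ m → ∃ λ a → ∃ λ b →
  (Consecutive j m × Consecutive m k) ×
  (Consecutive j a × Consecutive a b × Consecutive b k) ×
  (¬ Close m a × ¬ Close m b)

detour : ∀ j k → ¬ Close j k → Detour j k
detour = from-yes (all? {n = 5} λ j → all? λ k → ¬? (close? j k) →-dec
  any? λ m → any? λ a → any? λ b →
    (consecutive? j m ×-dec consecutive? m k) ×-dec
    (consecutive? j a ×-dec consecutive? a b ×-dec consecutive? b k) ×-dec
    (¬? (close? m a) ×-dec ¬? (close? m b)))

neighbourhood-determines : ∀ (k m : Fin 5) → (∀ j → Consecutive k j → Consecutive m j) → m ≡ k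
neighbourhood-determines = from-yes (all? {n = 5} λ k → all? λ m →
  all? (λ j → consecutive? k j →-dec consecutive? m j) →-dec (m ≟ᶠ k))

CloseGaps : (Fin 5 → Set) → Set
CloseGaps N = ∀ j k → ¬ N j → ¬ N k → Close j k

odd-cycle : ∀ {a b c d e} → b ≡ not a → c ≡ not b → d ≡ not c → e ≡ not d → a ≢ not e
odd-cycle {true}  refl refl refl refl ()
odd-cycle {false} refl refl refl refl ()

module _ {N : Fin 5 → Set} (N? : ∀ j → Dec (N j)) (N-gaps : CloseGaps N) where

  inhabited : ∃ N
  inhabited with N? (# 0) | N? (# 2)
  ... | yes N₀ | _      = # 0 , N₀
  ... | no _   | yes N₂ = # 2 , N₂
  ... | no ¬N₀ | no ¬N₂ = ⊥-elim (pentagram (# 0) (N-gaps (# 0) (# 2) ¬N₀ ¬N₂))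

  member-away-from-gap : ∀ {m a} → ¬ N m → ¬ Close m a → N a
  member-away-from-gap {m} {a} ¬Nm m≉a with N? a
  ... | yes Na  = Na
  ... | no  ¬Na = ⊥-elim (m≉a (N-gaps m a ¬Nm ¬Na))

  propagate : {E : Fin 5 → Set} → (∀ {j k} → Consecutive j k → N j → N k → E j → E k) →
              ∀ {j k} → N j → N k → E j → E k
  propagate {E} step {j} {k} Nj Nk with close? j k
  ... | yes (inj₁ refl) = id
  ... | yes (inj₂ j~k)  = step j~k Nj Nk
  ... | no j≉k          = around (detour j k j≉k)
    where
    around : Detour j k → E j → E k
    around (m , a , b , (j~m , m~k) , (j~a , a~b , b~k) , (m≉a , m≉b)) with N? m
    ... | yes Nm = step m~k Nm Nk ∘ step j~m Nj Nm
    ... | no ¬Nm = step b~k Nb Nk ∘ step a~b Na Nb ∘ step j~a Nj Na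
      where
      Na = member-away-from-gap ¬Nm m≉a
      Nb = member-away-from-gap ¬Nm m≉b

  -- Otherwise membership in N would 2-colour the pentagram 0-2-4-1-3, an odd cycle.
  common-member : ∀ {M : Fin 5 → Set} → (∀ j → Dec (M j)) → CloseGaps M → ∃ λ j → N j × M j
  common-member {M} M? M-gaps with any? (λ j → N? j ×-dec M? j)
  ... | yes found = found
  ... | no none    = ⊥-elim (odd-cycle (alternates (# 0)) (alternates (# 2)) (alternates (# 4))
                                        (alternates (# 1)) (alternates (# 3)))
    where
    alternates : ∀ j → does (N? (next (next j))) ≡ not (does (N? j))
    alternates j with N? j | N? (next (next j))
    ... | yes Nj | yes Nj₂ =
      ⊥-elim (pentagram j (M-gaps j _ (λ Mj → none (j , Nj , Mj)) (λ Mj₂ → none (_ , Nj₂ , Mj₂))))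
    ... | yes _  | no _    = refl
    ... | no _   | yes _   = refl
    ... | no ¬Nj | no ¬Nj₂ = ⊥-elim (pentagram j (N-gaps j _ ¬Nj ¬Nj₂))

open xor-∧-Solver

triangle : Vert → Vert → Vert → Fin 3 → Vert
triangle x y z zero             = x
triangle x y z (suc zero)       = y
triangle x y z (suc (suc zero)) = z

distinct⇒consecutive : ∀ (j k : Fin 3) → j ≢ k → Consecutive j k
distinct⇒consecutive = from-yes (all? {n = 3} λ j → all? λ k → ¬? (j ≟ᶠ k) →-dec consecutive? j k)

consecutive⇒distinct : ∀ (j k : Fin 3) → Consecutive j k → j ≢ k
consecutive⇒distinct = from-yes (all? {n = 3} λ j → all? λ k → consecutive? j k →-dec ¬? (j ≟ᶠ k))

triangle-induced : ∀ {x y z} → Adj x y → Adj y z → Adj x z → InducedCycle 0 (triangle x y z)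
triangle-induced {x} {y} {z} xy yz xz =
  injective , λ j k →
    mk⇔ (distinct⇒consecutive j k ∘ adjacent⇒distinct) (adjacent j k ∘ consecutive⇒distinct j k)
  where
  c = triangle x y z
  adjacent : ∀ j k → j ≢ k → Adj (c j) (c k)
  adjacent zero             zero             j≢k = ⊥-elim (j≢k refl)
  adjacent zero             (suc zero)       _   = xy
  adjacent zero             (suc (suc zero)) _   = xz
  adjacent (suc zero)       zero             _   = Adj-sym xy
  adjacent (suc zero)       (suc zero)       j≢k = ⊥-elim (j≢k refl)
  adjacent (suc zero)       (suc (suc zero)) _   = yz
  adjacent (suc (suc zero)) zero             _   = Adj-sym xz
  adjacent (suc (suc zero)) (suc zero)       _   = Adj-sym yz
  adjacent (suc (suc zero)) (suc (suc zero)) j≢k = ⊥-elim (j≢k refl)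
  adjacent⇒distinct : ∀ {j k} → Adj (c j) (c k) → j ≢ k
  adjacent⇒distinct cjk refl = Adj-irrefl cjk
  injective : ∀ j k → c j ≡ c k → j ≡ k
  injective j k cj≡ck with j ≟ᶠ k
  ... | yes j≡k = j≡k
  ... | no  j≢k = ⊥-elim (proj₁ (adjacent j k j≢k) cj≡ck)

TriangleRule : Labelling → Set
TriangleRule σ = ∀ {x y a} → Adj x y → Adj x a → Adj y a → σ x y ≡ σ x a xor σ y a

triangle-rule : ∀ {σ} → SymmetricOnEdges σ → AntiEvenBalancing σ → TriangleRule σ
triangle-rule {σ} σ-sym balanced {x} {y} {a} xy xa ya = begin
  σ x y
    ≡⟨ solve 3 (λ s t u → s := (s :+ (t :+ (u :+ con false))) :+ (t :+ u)) refl (σ x y) (σ y a) (σ a x) ⟩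
  cycleSum σ (triangle x y a) xor σ y a xor σ a x
    ≡⟨ cong (λ b → b xor σ y a xor σ a x) (balanced 0 _ (triangle-induced xy ya xa)) ⟩
  σ y a xor σ a x
    ≡⟨ cong (σ y a xor_) (σ-sym a x (Adj-sym xa)) ⟩
  σ y a xor σ x a
    ≡⟨ xor-comm (σ y a) (σ x a) ⟩
  σ x a xor σ y a
    ∎

switch : (Vert → Bool) → Labelling → Labelling
switch i σ x y = σ x y xor i x xor i y

module _ {i : Vert → Bool} {σ : Labelling} where

  switch-symmetric : SymmetricOnEdges σ → SymmetricOnEdges (switch i σ)
  switch-symmetric σ-sym x y xy = cong₂ _xor_ (σ-sym x y xy) (xor-comm (i x) (i y))

  switch-triangle-rule : TriangleRule σ → TriangleRule (switch i σ)
  switch-triangle-rule rule {x} {y} {a} xy xa ya = begin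
    σ x y xor i x xor i y
      ≡⟨ cong (λ s → s xor i x xor i y) (rule xy xa ya) ⟩
    (σ x a xor σ y a) xor i x xor i y
      ≡⟨ solve 5 (λ s t ix iy ia → (s :+ t) :+ (ix :+ iy) := (s :+ (ix :+ ia)) :+ (t :+ (iy :+ ia)))
                 refl (σ x a) (σ y a) (i x) (i y) (i a) ⟩
    (σ x a xor i x xor i a) xor (σ y a xor i y xor i a)
      ∎

  switch-on-tree : ∀ {p} → ExtendsσT i p σ → ∀ {x j} → IsPx p x j → switch i σ x (p j) ≡ i (p j)
  switch-on-tree {p} tree {x} {j} isPx = begin
    σ x (p j) xor i x xor i (p j) ≡⟨ cong (λ s → s xor i x xor i (p j)) (tree x j isPx) ⟩
    i x xor i x xor i (p j)       ≡⟨ solve 2 (λ ix ip → ix :+ (ix :+ ip) := ip) refl (i x) (i (p j)) ⟩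
    i (p j)                       ∎

module FiveCycle (p : Fin 5 → Vert) (five-cycle : InducedFiveCycle p) where

  p-injective : ∀ j k → p j ≡ p k → j ≡ k
  p-injective = proj₁ five-cycle

  p-adjacency : ∀ j k → Adj (p j) (p k) ⇔ Consecutive j k
  p-adjacency = proj₂ five-cycle

  Outside : Vert → Set
  Outside v = ∀ j → v ≢ p j

  ∈P? : ∀ v → (∃ λ k → v ≡ p k) ⊎ Outside v
  ∈P? v with any? (λ k → v ≟ᵥ p k)
  ... | yes found = inj₁ found
  ... | no  none  = inj₂ (λ k v≡pk → none (k , v≡pk))

  P-neighbour? : ∀ v j → Dec (Adj v (p j))
  P-neighbour? v j = Adj? v (p j)

  SamePNeighbours : Vert → Vert → Set
  SamePNeighbours v w = ∀ j → Adj v (p j) ⇔ Adj w (p j)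

  P-non-neighbours-close : ∀ {v} → Outside v → CloseGaps (λ j → Adj v (p j))
  P-non-neighbours-close v∉P j k ¬vj ¬vk with j ≟ᶠ k
  ... | yes j≡k = inj₁ j≡k
  ... | no  j≢k = inj₂ (to (p-adjacency j k)
                         (non-neighbours-adjacent (v∉P j) (v∉P k) (j≢k ∘ p-injective j k) ¬vj ¬vk))

  same-P-neighbours⇒≡p : ∀ {k w} → SamePNeighbours (p k) w → w ≡ p k
  same-P-neighbours⇒≡p {k} {w} same with ∈P? w
  ... | inj₁ (m , refl) = cong p (neighbourhood-determines k m λ j k~j →
                            to (p-adjacency m j) (to (same j) (from (p-adjacency k j) k~j)))
  ... | inj₂ w∉P        =
    ⊥-elim (pentagram k (P-non-neighbours-close w∉P k _ (Adj-irrefl ∘ from (same k)) ¬w-k₂))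
    where
    ¬w-k₂ : ¬ Adj w (p (next (next k)))
    ¬w-k₂ w-k₂ = pentagram k (inj₂ (to (p-adjacency k _) (from (same _) w-k₂)))

  IsPx-transfer : ∀ {v w j} → SamePNeighbours v w → IsPx p v j → IsPx p w j
  IsPx-transfer same (vj , below) = to (same _) vj , λ k k<j → below k k<j ∘ from (same k)

  Px-exists : ∀ {v} → Outside v → ∃ (IsPx p v)
  Px-exists {v} v∉P = least-witness (P-neighbour? v) (inhabited (P-neighbour? v) (P-non-neighbours-close v∉P))

  common-P-neighbour : ∀ {x y} → Outside x → Outside y → ∃ λ j → Adj x (p j) × Adj y (p j)
  common-P-neighbour {x} {y} x∉P y∉P =
    common-member (P-neighbour? x) (P-non-neighbours-close x∉P) (P-neighbour? y) (P-non-neighbours-close y∉P)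

module Switched (i : Vert → Bool) (p : Fin 5 → Vert) (five-cycle : InducedFiveCycle p)
                (σ : Labelling) (σ-spec : IsSigmaC3 i p σ) where

  open FiveCycle p five-cycle

  τ : Labelling
  τ = switch i σ

  τ-sym : SymmetricOnEdges τ
  τ-sym = switch-symmetric {i} (proj₁ σ-spec)

  τ-rule : TriangleRule τ
  τ-rule = switch-triangle-rule {i} (triangle-rule (proj₁ σ-spec) (proj₁ (proj₂ σ-spec)))

  τ-tree : ∀ {x j} → IsPx p x j → τ x (p j) ≡ i (p j)
  τ-tree = switch-on-tree {i} {σ} (proj₂ (proj₂ σ-spec))

  τ-determined-by-P-neighbours : ∀ {x w j} → Outside x → SamePNeighbours x w → Adj x (p j) →
                                 τ x (p j) ≡ τ w (p j)
  τ-determined-by-P-neighbours {x} {w} x∉P same xj =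
    let _ , isPx = Px-exists x∉P in
    propagate (P-neighbour? x) (P-non-neighbours-close x∉P) {E = λ j → τ x (p j) ≡ τ w (p j)}
      step (proj₁ isPx) xj (base isPx)
    where
    base : ∀ {j₀} → IsPx p x j₀ → τ x (p j₀) ≡ τ w (p j₀)
    base isPx = trans (τ-tree isPx) (sym (τ-tree (IsPx-transfer same isPx)))
    step : ∀ {k l} → Consecutive k l → Adj x (p k) → Adj x (p l) →
           τ x (p k) ≡ τ w (p k) → τ x (p l) ≡ τ w (p l)
    step {k} {l} k~l xk xl eq = begin
      τ x (p l)                   ≡⟨ τ-rule xl xk lk ⟩
      τ x (p k) xor τ (p l) (p k) ≡⟨ cong (_xor τ (p l) (p k)) eq ⟩
      τ w (p k) xor τ (p l) (p k) ≡⟨ sym (τ-rule (to (same l) xl) (to (same k) xk) lk) ⟩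
      τ w (p l)                   ∎
      where lk = Adj-sym (from (p-adjacency k l) k~l)

  module _ (X : Vert → Set) (f : (x : Vert) → .(X x) → Vert)
           (f-adj : ∀ x y (hx : X x) (hy : X y) → Adj x y → Adj (f x hx) (f y hy))
           (f-P : PreservesP p X f) where

    f-same-P-neighbours : ∀ v (hv : X v) → SamePNeighbours v (f v hv)
    f-same-P-neighbours v hv j = mk⇔ (Adj-sym ∘ to (f-P v hv j) ∘ Adj-sym) (Adj-sym ∘ from (f-P v hv j) ∘ Adj-sym)

    f-fixes-P : ∀ k (hk : X (p k)) → f (p k) hk ≡ p k
    f-fixes-P k hk = same-P-neighbours⇒≡p (f-same-P-neighbours (p k) hk)

    τ-at-P-preserved : ∀ v (hv : X v) {j} → Adj v (p j) → τ (f v hv) (p j) ≡ τ v (p j)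
    τ-at-P-preserved v hv vj with ∈P? v
    ... | inj₁ (k , refl) = cong (λ w → τ w _) (f-fixes-P k hv)
    ... | inj₂ v∉P        = sym (τ-determined-by-P-neighbours v∉P (f-same-P-neighbours v hv) vj)

    τ-preserved-towards-P : ∀ x (hx : X x) {k} (hk : X (p k)) → Adj x (p k) → τ (f x hx) (f (p k) hk) ≡ τ x (p k)
    τ-preserved-towards-P x hx {k} hk xk = trans (cong (τ (f x hx)) (f-fixes-P k hk)) (τ-at-P-preserved x hx xk)

    τ-preserved : ∀ x y (hx : X x) (hy : X y) → Adj x y → τ (f x hx) (f y hy) ≡ τ x y
    τ-preserved x y hx hy xy with ∈P? x | ∈P? y
    ... | _               | inj₁ (k , refl) = τ-preserved-towards-P x hx hy xy
    ... | inj₁ (k , refl) | inj₂ _          = begin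
      τ (f x hx) (f y hy) ≡⟨ τ-sym _ _ (f-adj x y hx hy xy) ⟩
      τ (f y hy) (f x hx) ≡⟨ τ-preserved-towards-P y hy hx (Adj-sym xy) ⟩
      τ y x               ≡⟨ τ-sym y x (Adj-sym xy) ⟩
      τ x y               ∎
    ... | inj₂ x∉P        | inj₂ y∉P with common-P-neighbour x∉P y∉P
    ... | j , xj , yj = begin
      τ (f x hx) (f y hy)
        ≡⟨ τ-rule (f-adj x y hx hy xy) (to (f-same-P-neighbours x hx j) xj) (to (f-same-P-neighbours y hy j) yj) ⟩
      τ (f x hx) (p j) xor τ (f y hy) (p j)
        ≡⟨ cong₂ _xor_ (τ-at-P-preserved x hx xj) (τ-at-P-preserved y hy yj) ⟩
      τ x (p j) xor τ y (p j)
        ≡⟨ sym (τ-rule xy xj yj) ⟩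
      τ x y
        ∎

unswitch : ∀ s s′ a a′ b b′ → s′ xor a′ xor b′ ≡ s xor a xor b → s′ ≡ s xor a xor a′ xor b xor b′
unswitch s s′ a a′ b b′ eq = begin
  s′
    ≡⟨ solve 3 (λ s′ a′ b′ → s′ := (s′ :+ (a′ :+ b′)) :+ (a′ :+ b′)) refl s′ a′ b′ ⟩
  (s′ xor a′ xor b′) xor a′ xor b′
    ≡⟨ cong (λ t → t xor a′ xor b′) eq ⟩
  (s xor a xor b) xor a′ xor b′
    ≡⟨ solve 5 (λ s a a′ b b′ → (s :+ (a :+ b)) :+ (a′ :+ b′) := s :+ (a :+ (a′ :+ (b :+ b′))))
               refl s a a′ b b′ ⟩
  s xor a xor a′ xor b xor b′
    ∎

lemma3p3 : (i : Vert → Bool) → DenseClass i false → DenseClass i true →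
    (p : Fin 5 → Vert) → InducedFiveCycle p →
    (σ : Labelling) → IsSigmaC3 i p σ →
    (X Y : Vert → Set) (f : (x : Vert) → .(X x) → Vert) →
    IsInducedIso X Y f → PreservesP p X f →
    ∀ x y (hx : X x) (hy : X y) → Adj x y →
    σ (f x hx) (f y hy) ≡ σ x y xor i x xor i (f x hx) xor i y xor i (f y hy)
lemma3p3 i _ _ p five-cycle σ σ-spec X _ f (_ , _ , _ , f-iso) f-P x y hx hy xy =
  unswitch (σ x y) (σ (f x hx) (f y hy)) (i x) (i (f x hx)) (i y) (i (f y hy))
    (τ-preserved X f (λ u v hu hv → to (f-iso u v hu hv)) f-P x y hx hy xy)
  where open Switched i p five-cycle σ σ-spec
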